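{- Let $k\geq 2$, let $G=(V,E)$ be a graph and let $u,v\in V$ with $uv\notin E$. If $u$ and $v$ are clear non-neighbors, then for every graph $G'$ on $V$ with $\mathcal{S}_k(G')=\mathcal{S}_k(G)$ and $\overline{\mathcal{S}}_k(G')=\overline{\mathcal{S}}_k(G)$, we have $uv\notin E(G')$.
   Context: $\mathcal{S}_k(G)$ (resp. $\overline{\mathcal{S}}_k(G)$) denotes the set of $k$-subsets of $V$ inducing a connected (resp. disconnected) subgraph of $G$. For $uv\notin E$, $u$ and $v$ are clear non-neighbors if (i) there exists $S\in\mathcal{S}_k(G)$ with $v\in S$, $u\notin S$ such that for every $v'\in S\setminus\{v\}$, $(S\setminus\{v'\})\cup\{u\}\in\overline{\mathcal{S}}_k(G)$, or (ii) there exists $S\in\mathcal{S}_k(G)$ with $u\in S$, $v\notin S$ such that for every $u'\in S\setminus\{u\}$, $(S\setminus\{u'\})\cup\{v\}\in\overline{\mathcal{S}}_k(G)$. -}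

module Defs where

open import Level using (0ℓ)
open import Data.Nat using (ℕ)
open import Data.Fin using (Fin)
open import Data.Fin.Subset using (Subset; _∈_; _∉_; ∣_∣; _∪_; _-_; ⁅_⁆)
open import Data.Product using (Σ; _×_; _,_)
open import Relation.Nullary using (¬_; Dec)
open import Relation.Binary.PropositionalEquality using (_≡_; _≢_)

record Graph (n : ℕ) : Set₁ where
  field
    Adj    : Fin n → Fin n → Set
    sym    : ∀ {x y} → Adj x y → Adj y x
    irrefl : ∀ {x} → ¬ Adj x x
    dec    : ∀ x y → Dec (Adj x y)
open Graph public

data PathIn {n : ℕ} (G : Graph n) (S : Subset n) : Fin n → Fin n → Set where
  here : ∀ {x} → x ∈ S → PathIn G S x x
  step : ∀ {x y z} → x ∈ S → Adj G x y → PathIn G S y z → PathIn G S x z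

Connected : {n : ℕ} → Graph n → Subset n → Set
Connected G S = ∀ x y → x ∈ S → y ∈ S → PathIn G S x y

Disconnected : {n : ℕ} → Graph n → Subset n → Set
Disconnected G S = ¬ Connected G S

InSk : {n : ℕ} → ℕ → Graph n → Subset n → Set
InSk k G S = (∣ S ∣ ≡ k) × Connected G S

InSbark : {n : ℕ} → ℕ → Graph n → Subset n → Set
InSbark k G S = (∣ S ∣ ≡ k) × Disconnected G S

swap : {n : ℕ} → Subset n → Fin n → Fin n → Subset n
swap S w u = (S - w) ∪ ⁅ u ⁆

ClearWitness : {n : ℕ} → ℕ → Graph n → Fin n → Fin n → Set
ClearWitness k G u v =
  Σ (Subset _) λ S → InSk k G S × v ∈ S × u ∉ S ×
    (∀ v' → v' ∈ S → v' ≢ v → InSbark k G (swap S v' u))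

data ClearNonNeighbors {n : ℕ} (k : ℕ) (G : Graph n) (u v : Fin n) : Set where
  cond-i  : ¬ Adj G u v → ClearWitness k G u v → ClearNonNeighbors k G u v
  cond-ii : ¬ Adj G u v → ClearWitness k G v u → ClearNonNeighbors k G u v

-- In G′ the set S of a clear witness is connected, so a vertex w ≠ v of S
-- farthest from v in G′[S] is not a cut vertex: every other vertex of S
-- reaches v along a shortest walk, which cannot pass through w. If uv were
-- an edge of G′, then (S ∖ {w}) ∪ {u} would be connected in G′, whereas the
-- witness makes it disconnected in G and hence in G′.
module Submission where

open import Defs
open import Data.Nat using (ℕ; zero; suc; _≤_; _≥_; z≤n; s≤s; _⊔_)
open import Data.Nat.Properties using (≤-trans; ≤-reflexive; m≤m⊔n; m≤n⊔m)
open import Data.Fin using (Fin; _≟_)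
import Data.Fin as Fin
open import Data.Fin.Properties using (any?; all?; ¬∀⟶∃¬)
open import Data.Fin.Subset using (Subset; _∈_; _∪_; _-_; ⁅_⁆; _⊆_; ∣_∣)
open import Data.Fin.Subset.Properties
  using (_∈?_; x∈p∪q⁻; x∈p∪q⁺; x∈⁅y⁆⇒x≡y; x∈⁅x⁆; x∈p∧x≢y⇒x∈p-y; p─q⊆p; p⊆q⇒∣p∣≤∣q∣; ∣⁅x⁆∣≡1)
open import Data.Product using (_×_; _,_; ∃; proj₁; proj₂)
open import Data.Sum using (_⊎_; inj₁; inj₂)
open import Data.Empty using (⊥-elim)
open import Function using (_∘_; const)
open import Function.Bundles using (_⇔_)
open Function.Bundles.Equivalence using (from)
open import Relation.Nullary using (¬_; yes; no; ¬?; contradiction)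
open import Relation.Nullary.Decidable using (_⊎-dec_; _×-dec_; _→-dec_; decidable-stable)
open import Relation.Unary using (Decidable)
open import Relation.Binary.PropositionalEquality using (_≡_; _≢_; refl) renaming (sym to ≡-sym)

module _ {n} {G : Graph n} where

  PathIn-source∈ : ∀ {T x y} → PathIn G T x y → x ∈ T
  PathIn-source∈ (here x∈T)     = x∈T
  PathIn-source∈ (step x∈T _ _) = x∈T

  PathIn-++ : ∀ {T x y z} → PathIn G T x y → PathIn G T y z → PathIn G T x z
  PathIn-++ (here _)         q = q
  PathIn-++ (step x∈T xy p) q = step x∈T xy (PathIn-++ p q)

  PathIn-reverse : ∀ {T x y} → PathIn G T x y → PathIn G T y x
  PathIn-reverse (here x∈T)      = here x∈T
  PathIn-reverse (step x∈T xy p) =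
    PathIn-++ (PathIn-reverse p) (step (PathIn-source∈ p) (Graph.sym G xy) (here x∈T))

  PathIn-⊆ : ∀ {T T′ x y} → T ⊆ T′ → PathIn G T x y → PathIn G T′ x y
  PathIn-⊆ T⊆T′ (here x∈T)      = here (T⊆T′ x∈T)
  PathIn-⊆ T⊆T′ (step x∈T xy p) = step (T⊆T′ x∈T) xy (PathIn-⊆ T⊆T′ p)

  hub⇒connected : ∀ {T h} → (∀ x → x ∈ T → PathIn G T x h) → Connected G T
  hub⇒connected toHub x y x∈T y∈T = PathIn-++ (toHub x x∈T) (PathIn-reverse (toHub y y∈T))

  hub⇒connected-∪-neighbour : ∀ {T h a} → (∀ x → x ∈ T → PathIn G T x h) → h ∈ T →
                              Adj G a h → Connected G (T ∪ ⁅ a ⁆)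
  hub⇒connected-∪-neighbour {T} {h} {a} toHub h∈T ah = hub⇒connected toHub′
    where
    T⊆T∪a : T ⊆ T ∪ ⁅ a ⁆
    T⊆T∪a = x∈p∪q⁺ ∘ inj₁

    toHub′ : ∀ x → x ∈ T ∪ ⁅ a ⁆ → PathIn G (T ∪ ⁅ a ⁆) x h
    toHub′ x x∈T∪a with x∈p∪q⁻ T ⁅ a ⁆ x∈T∪a
    ... | inj₁ x∈T = PathIn-⊆ T⊆T∪a (toHub x x∈T)
    ... | inj₂ x∈a with x∈⁅y⁆⇒x≡y a x∈a
    ...   | refl = step x∈T∪a ah (here (T⊆T∪a h∈T))

uniform-bound : ∀ {n} (P : ℕ → Fin n → Set) → (∀ {m m′ x} → m ≤ m′ → P m x → P m′ x) →
                (∀ x → ∃ λ m → P m x) → ∃ λ M → ∀ x → P M x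
uniform-bound {zero}  P mono bound = 0 , λ ()
uniform-bound {suc n} P mono bound with uniform-bound (λ m → P m ∘ Fin.suc) mono (bound ∘ Fin.suc)
                                      | bound Fin.zero
... | M , P-M | m₀ , P-m₀ = M ⊔ m₀ , λ where
  Fin.zero    → mono (m≤n⊔m M m₀) P-m₀
  (Fin.suc x) → mono (m≤m⊔n M m₀) (P-M x)

rising-edge : {P : ℕ → Set} → Decidable P → ¬ P 0 → ∀ {N} → P N → ∃ λ m → ¬ P m × P (suc m)
rising-edge P? ¬P0 {zero}  P0 = contradiction P0 ¬P0
rising-edge P? ¬P0 {suc N} PsN with P? N
... | yes PN = rising-edge P? ¬P0 PN
... | no ¬PN = N , ¬PN , PsN

2≤∣p∣⇒∃x∈p∧x≢y : ∀ {n} {p : Subset n} (y : Fin n) → 2 ≤ ∣ p ∣ →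
                  ∃ λ x → x ∈ p × x ≢ y
2≤∣p∣⇒∃x∈p∧x≢y {p = p} y 2≤∣p∣ with any? (λ x → (x ∈? p) ×-dec ¬? (x ≟ y))
... | yes (x , x∈p , x≢y) = x , x∈p , x≢y
... | no ∄x = contradiction
        (≤-trans 2≤∣p∣ (≤-trans (p⊆q⇒∣p∣≤∣q∣ p⊆⁅y⁆) (≤-reflexive (∣⁅x⁆∣≡1 y))))
        λ { (s≤s ()) }
  where
  p⊆⁅y⁆ : p ⊆ ⁅ y ⁆
  p⊆⁅y⁆ {x} x∈p with x ≟ y
  ... | yes refl = x∈⁅x⁆ y
  ... | no x≢y   = contradiction (x , x∈p , x≢y) ∄x

module Layers {n} (G : Graph n) (T : Subset n) (v : Fin n) where

  Within : ℕ → Fin n → Set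
  Within zero    x = x ≡ v
  Within (suc m) x = Within m x ⊎ (x ∈ T × ∃ λ y → Adj G x y × Within m y)

  within? : ∀ m → Decidable (Within m)
  within? zero    x = x ≟ v
  within? (suc m) x = within? m x ⊎-dec ((x ∈? T) ×-dec any? (λ y → Graph.dec G x y ×-dec within? m y))

  within-mono : ∀ {m m′ x} → m ≤ m′ → Within m x → Within m′ x
  within-mono {zero}  {zero}   _          x≡v      = x≡v
  within-mono {zero}  {suc m′} _          x≡v      = inj₁ (within-mono {m′ = m′} z≤n x≡v)
  within-mono {suc m} {suc m′} (s≤s m≤m′) (inj₁ w) = inj₁ (within-mono m≤m′ w)
  within-mono {suc m} {suc m′} (s≤s m≤m′) (inj₂ (x∈T , y , xy , w)) =
    inj₂ (x∈T , y , xy , within-mono m≤m′ w)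

  path⇒within : ∀ {x} → PathIn G T x v → ∃ λ m → Within m x
  path⇒within (here _) = 0 , refl
  path⇒within (step x∈T xy p) with path⇒within p
  ... | m , w = suc m , inj₂ (x∈T , _ , xy , w)

  -- A witnessing walk for Within m x only visits vertices within distance m.
  within⇒path-avoiding : v ∈ T → ∀ {m x w} → ¬ Within m w → Within m x → PathIn G (T - w) x v
  within⇒path-avoiding v∈T {zero} ¬w refl = here (x∈p∧x≢y⇒x∈p-y v∈T λ { refl → ¬w refl })
  within⇒path-avoiding v∈T {suc m} ¬w (inj₁ x-within) =
    within⇒path-avoiding v∈T (¬w ∘ inj₁) x-within
  within⇒path-avoiding v∈T {suc m} ¬w (inj₂ (x∈T , y , xy , y-within)) =
    step (x∈p∧x≢y⇒x∈p-y x∈T λ { refl → ¬w (inj₂ (x∈T , y , xy , y-within)) })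
         xy (within⇒path-avoiding v∈T (¬w ∘ inj₁) y-within)

  AllWithin : ℕ → Set
  AllWithin m = ∀ x → x ∈ T → Within m x

  allWithin? : Decidable AllWithin
  allWithin? m = all? (λ x → (x ∈? T) →-dec within? m x)

  connected⇒allWithin : Connected G T → v ∈ T → ∃ AllWithin
  connected⇒allWithin conn v∈T =
    uniform-bound (λ m x → x ∈ T → Within m x) (λ m≤m′ w x∈T → within-mono m≤m′ (w x∈T)) bound
    where
    bound : ∀ x → ∃ λ m → x ∈ T → Within m x
    bound x with x ∈? T
    ... | yes x∈T = let m , w = path⇒within (conn x v x∈T v∈T) in m , const w
    ... | no  x∉T = 0 , λ x∈T → contradiction x∈T x∉T

  ¬allWithin⇒far : ∀ {m} → ¬ AllWithin m → ∃ λ w → w ∈ T × ¬ Within m w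
  ¬allWithin⇒far {m} ¬all with ¬∀⟶∃¬ n _ (λ x → (x ∈? T) →-dec within? m x) ¬all
  ... | w , ¬w = w , decidable-stable (w ∈? T) (λ w∉T → ¬w (⊥-elim ∘ w∉T)) , ¬w ∘ const

  ∃-non-cut-vertex : ∀ {w₀} → Connected G T → v ∈ T → w₀ ∈ T → w₀ ≢ v →
                     ∃ λ w → w ∈ T × w ≢ v × (∀ x → x ∈ T - w → PathIn G (T - w) x v)
  -- suc M is the eccentricity of v in G[T], and w is a vertex at that distance.
  ∃-non-cut-vertex {w₀} conn v∈T w₀∈T w₀≢v
    with connected⇒allWithin conn v∈T
  ... | N , allN with rising-edge allWithin? (λ all0 → w₀≢v (all0 w₀ w₀∈T)) allN
  ... | M , ¬allM , allsM with ¬allWithin⇒far ¬allM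
  ... | w , w∈T , ¬w =
    w , w∈T , (λ { refl → ¬w (within-mono z≤n refl) }) , toV
    where
    toV : ∀ x → x ∈ T - w → PathIn G (T - w) x v
    toV x x∈T-w with allsM x (p─q⊆p T ⁅ w ⁆ x∈T-w)
    ... | inj₁ x-within                = within⇒path-avoiding v∈T ¬w x-within
    ... | inj₂ (_ , y , xy , y-within) = step x∈T-w xy (within⇒path-avoiding v∈T ¬w y-within)

clearWitness⇒¬Adj : ∀ {k n} → k ≥ 2 → (G G′ : Graph n) → ∀ {a b} → ClearWitness k G a b →
                    (∀ S → InSk k G′ S ⇔ InSk k G S) → (∀ S → InSbark k G′ S ⇔ InSbark k G S) →
                    ¬ Adj G′ a b
clearWitness⇒¬Adj k≥2 G G′ {a} {b} (S , S∈Sk , b∈S , _ , swap∈S̄k) same same̅ ab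
  with 2≤∣p∣⇒∃x∈p∧x≢y b (≤-trans k≥2 (≤-reflexive (≡-sym (proj₁ S∈Sk))))
... | w₀ , w₀∈S , w₀≢b
  with Layers.∃-non-cut-vertex G′ S b (proj₂ (from (same S) S∈Sk)) b∈S w₀∈S w₀≢b
... | w , w∈S , w≢b , toB = disconnected connected
  where
  connected : Connected G′ (swap S w a)
  connected = hub⇒connected-∪-neighbour toB (x∈p∧x≢y⇒x∈p-y b∈S (w≢b ∘ ≡-sym)) ab

  disconnected : Disconnected G′ (swap S w a)
  disconnected = proj₂ (from (same̅ (swap S w a)) (swap∈S̄k w w∈S w≢b))

corollary2 : (k n : ℕ) → k ≥ 2 → (G : Graph n) → (u v : Fin n) →
    ¬ Adj G u v → ClearNonNeighbors k G u v →
    (G′ : Graph n) →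
    (∀ (S : Subset n) → InSk k G′ S ⇔ InSk k G S) →
    (∀ (S : Subset n) → InSbark k G′ S ⇔ InSbark k G S) →
    ¬ Adj G′ u v
corollary2 k n k≥2 G u v _ (cond-i _ witness) G′ same same̅ =
  clearWitness⇒¬Adj k≥2 G G′ witness same same̅
corollary2 k n k≥2 G u v _ (cond-ii _ witness) G′ same same̅ =
  clearWitness⇒¬Adj k≥2 G G′ witness same same̅ ∘ Graph.sym G′
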